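{- For every integer $a>0$, the full count matroid $\mathcal{M}(a,0)$ has the $k$-fold circuit property for all $k\geq 1$.
   Context: For a multigraph $H=(V,E)$ (loops allowed) and integers $0\leq b<2a$, the count matroid $\mathcal{M}_{a,b}(H)$ is the matroid on $E$ in which $F\subseteq E$ is independent iff $|F'|\leq a|V(F')|-b$ for all nonempty $F'\subseteq F$, where $V(F')$ is the set of vertices incident to $F'$. $K_n^{a,b}$ is the multigraph on $n$ vertices with $\max\{a-b,0\}$ loops at each vertex and $2a-b$ parallel edges between each pair of distinct vertices; the full count matroid is $\mathcal{M}(a,b)=\mathcal{M}_{a,b}(K_n^{a,b})$ (for any positive integer $n$). For a matroid with rank $r$ and closure $\mathrm{cl}(X)=\{x:r(X+x)=r(X)\}$: a cyclic set is a set $D$ with $r(D-e)=r(D)$ for all $e\in D$; a $k$-fold circuit is a cyclic set with $r(D)=|D|-k$; its principal partition is $\{D\setminus B: B\subseteq D\text{ a }(k-1)\text{ -fold circuit}\}$; a $k$-fold circuit with principal partition $\{A_1,\dots,A_\ell\}$ is balanced if $r(\bigcap_{i=1}^\ell\mathrm{cl}(D\setminus A_i))=\ell-k$; the matroid has the $k$-fold circuit property if all its $k$-fold circuits are balanced. -}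

module Defs where

open import Data.Nat using (ℕ; zero; suc; _+_; _*_; _∸_; _≤_; _⊔_)
open import Data.Nat.Properties using (_≟_; _≤?_)
open import Data.Bool using (Bool; true; false; if_then_else_)
open import Data.Product using (_×_; _,_; proj₁; proj₂)
open import Data.Fin using (Fin; _<?_)
open import Data.Fin.Subset using (Subset; inside; outside; _∈_; _⊆_; _∪_; _∩_; _─_; _-_; ⁅_⁆; ⋃; ⋂; ∣_∣; Nonempty)
open import Data.Fin.Subset.Properties using (_∈?_; _⊆?_; nonempty?)
open import Data.Fin.Properties using (all?)
open import Data.List using (List; []; _∷_; [_]; _++_; map; filter; foldr; length; concatMap; replicate; lookup; allFin)
open import Data.Vec using (Vec; []; _∷_; tabulate)
open import Relation.Nullary using (Dec; does)
open import Relation.Nullary.Decidable using (map′; _×-dec_; _→-dec_)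
open import Relation.Unary using (Decidable)
open import Relation.Binary.PropositionalEquality using (_≡_)

allSubsets : (m : ℕ) → List (Subset m)
allSubsets zero    = [ [] ]
allSubsets (suc m) = map (outside ∷_) s ++ map (inside ∷_) s
  where s = allSubsets m

∀ˢ? : ∀ {m} {P : Subset m → Set} → Decidable P → Dec (∀ p → P p)
∀ˢ? {zero} P? = map′ (λ x → λ { [] → x }) (λ f → f []) (P? [])
∀ˢ? {suc m} {P} P? =
  map′ (λ fg → λ { (outside ∷ p) → proj₁ fg p ; (inside ∷ p) → proj₂ fg p })
       (λ h → (λ p → h (outside ∷ p)) , (λ p → h (inside ∷ p)))
       (∀ˢ? (λ p → P? (outside ∷ p)) ×-dec ∀ˢ? (λ p → P? (inside ∷ p)))

maxℕ : List ℕ → ℕ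
maxℕ = foldr _⊔_ 0

-- Multigraphs (loops and parallel edges allowed):
-- vertex set Fin nV, edge set Fin nE, each edge has two (possibly equal) ends.

record Multigraph : Set where
  field
    nV   : ℕ
    nE   : ℕ
    ends : Fin nE → Fin nV × Fin nV

module CountMatroid (a b : ℕ) (H : Multigraph) where
  open Multigraph H

  V : Subset nE → Subset nV
  V F = ⋃ (map (λ e → ⁅ proj₁ (ends e) ⁆ ∪ ⁅ proj₂ (ends e) ⁆)
               (filter (_∈? F) (allFin nE)))

  -- F independent iff |F'| ≤ a|V(F')| - b for all nonempty F' ⊆ F
  -- (written |F'| + b ≤ a|V(F')| to avoid truncated subtraction)
  Independent : Subset nE → Set
  Independent F = ∀ F' → F' ⊆ F → Nonempty F' → ∣ F' ∣ + b ≤ a * ∣ V F' ∣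

  independent? : Decidable Independent
  independent? F = ∀ˢ? (λ F' → (F' ⊆? F) →-dec ((nonempty? F') →-dec (∣ F' ∣ + b ≤? a * ∣ V F' ∣)))

  rank : Subset nE → ℕ
  rank X = maxℕ (map ∣_∣ (filter (λ I → (I ⊆? X) ×-dec independent? I) (allSubsets nE)))

module MatroidNotions {m : ℕ} (r : Subset m → ℕ) where

  cl : Subset m → Subset m
  cl X = tabulate (λ x → does (r (X ∪ ⁅ x ⁆) ≟ r X))

  Cyclic : Subset m → Set
  Cyclic D = ∀ e → e ∈ D → r (D - e) ≡ r D

  cyclic? : Decidable Cyclic
  cyclic? D = all? (λ e → (e ∈? D) →-dec (r (D - e) ≟ r D))

  -- k-fold circuit: cyclic set D with r(D) = |D| - k  (written r(D) + k = |D|)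
  FoldCircuit : ℕ → Subset m → Set
  FoldCircuit k D = Cyclic D × (r D + k ≡ ∣ D ∣)

  foldCircuit? : ∀ k → Decidable (FoldCircuit k)
  foldCircuit? k D = cyclic? D ×-dec (r D + k ≟ ∣ D ∣)

  subCircuits : ℕ → Subset m → List (Subset m)
  subCircuits k D = filter (λ B → (B ⊆? D) ×-dec foldCircuit? (k ∸ 1) B) (allSubsets m)

  -- principal partition {D \ B : B ⊆ D a (k-1)-fold circuit}, as a
  -- duplicate-free list [A_1, …, A_ℓ]
  principalPartition : ℕ → Subset m → List (Subset m)
  principalPartition k D = map (D ─_) (subCircuits k D)

  -- balanced: r(⋂_i cl(D \ A_i)) = ℓ - k   (written r(…) + k = ℓ);
  -- ⋂ of the empty family is the whole ground set
  Balanced : ℕ → Subset m → Set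
  Balanced k D =
    let As = principalPartition k D in
    r (⋂ (map (λ A → cl (D ─ A)) As)) + k ≡ length As

  KFoldCircuitProperty : ℕ → Set
  KFoldCircuitProperty k = ∀ D → FoldCircuit k D → Balanced k D

Kedges : (n a b : ℕ) → List (Fin n × Fin n)
Kedges n a b =
  concatMap (λ v → replicate (a ∸ b) (v , v)) (allFin n)
  ++ concatMap (λ u → concatMap (λ v → if does (u <? v) then replicate ((2 * a) ∸ b) (u , v) else [])
                                (allFin n))
               (allFin n)

K : (n a b : ℕ) → Multigraph
K n a b = record { nV = n ; nE = length (Kedges n a b) ; ends = lookup (Kedges n a b) }

-- the full count matroid M(a,b) = M_{a,b}(K_n^{a,b}), via its rank function
rankM : (n a b : ℕ) → Subset (Multigraph.nE (K n a b)) → ℕ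
rankM n a b = CountMatroid.rank a b (K n a b)

HasKFoldCircuitProperty : (n a b k : ℕ) → Set
HasKFoldCircuitProperty n a b k = MatroidNotions.KFoldCircuitProperty (rankM n a b) k

-- For b = 0 the rank of the count matroid is given by the covering formula
--   r(X) = min_{Y ⊆ X} (|X ─ Y| + a|V(Y)|),
-- the minimum being attained because tight subsets of an independent set are closed under union
-- (|V(·)| is submodular). Consequently a set Z is a k-fold circuit iff |Z| = a|V(Z)| + k while every
-- proper subset Y has |Y| < a|V(Y)| + k; in particular r(B) = a|V(B)| for cyclic B, so cl(B) is the
-- set of edges spanned by V(B).
-- Let D be a (j+1)-fold circuit. Each edge e ∈ D is avoided by a j-fold circuit B ⊆ D (a minimal
-- subset of D - e of excess j), and submodularity shows that two distinct such B cover D. So the sets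
-- D ─ B, and likewise V(D) ─ V(B), are pairwise disjoint, with |D ─ B| = a|V(D) ─ V(B)| + 1; counting
-- gives ℓ = a|W| + j + 1 for W = ⋂ V(B). Finally ⋂ cl(D ─ A_i) = ⋂ cl(B) is the set of edges spanned
-- by W, which has rank a|W| because every vertex of K_n^{a,0} carries a loops.

module Submission where

open import Defs
open import Data.Nat using (ℕ; zero; suc; _+_; _*_; _∸_; _≤_; _<_; z≤n; s≤s; NonZero; >-nonZero)
open import Data.Nat.Properties
open import Data.Nat.ListAction using (sum)
open import Data.Nat.Induction using (<-wellFounded)
open import Data.Product using (_×_; _,_; proj₁; proj₂; ∃; ∃-syntax)
open import Data.Sum using (_⊎_; inj₁; inj₂; [_,_]′)
open import Data.Empty using (⊥-elim)
open import Data.Bool using (if_then_else_)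
open import Data.Fin using (Fin; zero; suc)
import Data.Fin as Fin
open import Data.Fin.Subset
open import Data.Fin.Subset.Properties
open import Data.Vec using ([]; _∷_; here; there; tabulate; lookup)
import Data.Vec as Vec
open import Data.Vec.Properties using (lookup∘tabulate; []=⇒lookup; lookup⇒[]=; ∷-injectiveʳ; tabulate-cong; tabulate∘lookup)
open import Data.List using (List; []; _∷_; _++_; map; filter; allFin; length; concatMap; replicate)
import Data.List as List
open import Data.List.Properties using (map-∘; length-map; length-++; filter-++; filter-all; filter-none; length-replicate)
open import Data.List.Membership.Propositional using () renaming (_∈_ to _∈ₗ_)
open import Data.List.Membership.Propositional.Properties
  using (∈-map⁺; ∈-map⁻; ∈-filter⁺; ∈-filter⁻; ∈-allFin; ∈-++⁺ˡ; ∈-++⁺ʳ)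
open import Data.List.Relation.Unary.Any using (here; there)
open import Data.List.Relation.Unary.All using (All; []; _∷_)
import Data.List.Relation.Unary.All as All
open import Data.List.Relation.Unary.All.Properties using (replicate⁺)
open import Data.List.Relation.Unary.AllPairs using ([]; _∷_)
open import Data.List.Relation.Unary.Unique.Propositional using (Unique)
import Data.List.Relation.Unary.Unique.Propositional.Properties as Unique
open import Algebra.Properties.CommutativeSemigroup +-commutativeSemigroup using (interchange)
open import Function using (_∘_; _on_)
open import Function.Bundles using (mk⇔)
open import Induction.WellFounded using (Acc; acc)
import Relation.Binary.Construct.On as On
open import Relation.Binary.PropositionalEquality using (_≡_; _≢_; refl; sym; trans; cong; cong₂; subst; module ≡-Reasoning)
open import Relation.Nullary using (¬_; yes; no; does)
open import Relation.Nullary.Decidable using (_×-dec_; dec-true; does-⇔; decidable-stable; toSum)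
open import Relation.Unary using (Pred; Decidable)
open import Level using (0ℓ)

private
  variable
    m n : ℕ
    p q r : Subset n
    x : Fin n

-- Finite subsets

x∈p─q⁻ : ∀ (p q : Subset n) → x ∈ p ─ q → x ∈ p × x ∉ q
x∈p─q⁻ (s ∷ p) (outside ∷ q) here      = here , λ ()
x∈p─q⁻ (s ∷ p) (t ∷ q)       (there x∈) with x∈p─q⁻ p q x∈
... | x∈p , x∉q = there x∈p , λ { (there x∈q) → x∉q x∈q }

∪-least : p ⊆ r → q ⊆ r → p ∪ q ⊆ r
∪-least {p = p} {q = q} p⊆r q⊆r x∈ with x∈p∪q⁻ p q x∈
... | inj₁ x∈p = p⊆r x∈p
... | inj₂ x∈q = q⊆r x∈q

∣p∪q∣+∣p∩q∣≡∣p∣+∣q∣ : ∀ (p q : Subset n) → ∣ p ∪ q ∣ + ∣ p ∩ q ∣ ≡ ∣ p ∣ + ∣ q ∣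
∣p∪q∣+∣p∩q∣≡∣p∣+∣q∣ []            []            = refl
∣p∪q∣+∣p∩q∣≡∣p∣+∣q∣ (outside ∷ p) (outside ∷ q) = ∣p∪q∣+∣p∩q∣≡∣p∣+∣q∣ p q
∣p∪q∣+∣p∩q∣≡∣p∣+∣q∣ (outside ∷ p) (inside ∷ q)  =
  trans (cong suc (∣p∪q∣+∣p∩q∣≡∣p∣+∣q∣ p q)) (sym (+-suc ∣ p ∣ ∣ q ∣))
∣p∪q∣+∣p∩q∣≡∣p∣+∣q∣ (inside ∷ p)  (outside ∷ q) = cong suc (∣p∪q∣+∣p∩q∣≡∣p∣+∣q∣ p q)
∣p∪q∣+∣p∩q∣≡∣p∣+∣q∣ (inside ∷ p)  (inside ∷ q)  = cong suc (begin
  ∣ p ∪ q ∣ + suc ∣ p ∩ q ∣ ≡⟨ +-suc _ _ ⟩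
  suc (∣ p ∪ q ∣ + ∣ p ∩ q ∣) ≡⟨ cong suc (∣p∪q∣+∣p∩q∣≡∣p∣+∣q∣ p q) ⟩
  suc (∣ p ∣ + ∣ q ∣)        ≡⟨ +-suc ∣ p ∣ ∣ q ∣ ⟨
  ∣ p ∣ + suc ∣ q ∣           ∎)
  where open ≡-Reasoning

∣p─q∣+∣p∩q∣≡∣p∣ : ∀ (p q : Subset n) → ∣ p ─ q ∣ + ∣ p ∩ q ∣ ≡ ∣ p ∣
∣p─q∣+∣p∩q∣≡∣p∣ []            []            = refl
∣p─q∣+∣p∩q∣≡∣p∣ (outside ∷ p) (outside ∷ q) = ∣p─q∣+∣p∩q∣≡∣p∣ p q
∣p─q∣+∣p∩q∣≡∣p∣ (outside ∷ p) (inside ∷ q)  = ∣p─q∣+∣p∩q∣≡∣p∣ p q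
∣p─q∣+∣p∩q∣≡∣p∣ (inside ∷ p)  (outside ∷ q) = cong suc (∣p─q∣+∣p∩q∣≡∣p∣ p q)
∣p─q∣+∣p∩q∣≡∣p∣ (inside ∷ p)  (inside ∷ q)  = trans (+-suc _ _) (cong suc (∣p─q∣+∣p∩q∣≡∣p∣ p q))

q⊆p⇒∣p─q∣+∣q∣≡∣p∣ : q ⊆ p → ∣ p ─ q ∣ + ∣ q ∣ ≡ ∣ p ∣
q⊆p⇒∣p─q∣+∣q∣≡∣p∣ {q = q} {p = p} q⊆p = begin
  ∣ p ─ q ∣ + ∣ q ∣     ≡⟨ cong (λ s → ∣ p ─ q ∣ + ∣ s ∣) p∩q≡q ⟨
  ∣ p ─ q ∣ + ∣ p ∩ q ∣ ≡⟨ ∣p─q∣+∣p∩q∣≡∣p∣ p q ⟩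
  ∣ p ∣                 ∎
  where
  open ≡-Reasoning
  p∩q≡q : p ∩ q ≡ q
  p∩q≡q = ⊆-antisym (p∩q⊆q p q) (λ x∈q → x∈p∩q⁺ (q⊆p x∈q , x∈q))

x∈p⇒∣p∣≡1+∣p-x∣ : x ∈ p → ∣ p ∣ ≡ suc ∣ p - x ∣
x∈p⇒∣p∣≡1+∣p-x∣ {x = x} {p = p} x∈p = begin
  ∣ p ∣                 ≡⟨ q⊆p⇒∣p─q∣+∣q∣≡∣p∣ ⁅x⁆⊆p ⟨
  ∣ p - x ∣ + ∣ ⁅ x ⁆ ∣ ≡⟨ cong (∣ p - x ∣ +_) (∣⁅x⁆∣≡1 x) ⟩
  ∣ p - x ∣ + 1         ≡⟨ +-comm ∣ p - x ∣ 1 ⟩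
  suc ∣ p - x ∣         ∎
  where
  open ≡-Reasoning
  ⁅x⁆⊆p : ⁅ x ⁆ ⊆ p
  ⁅x⁆⊆p y∈ = subst (_∈ p) (sym (x∈⁅y⁆⇒x≡y x y∈)) x∈p

⊆∪⁅x⁆⇒-x⊆ : p ⊆ q ∪ ⁅ x ⁆ → p - x ⊆ q
⊆∪⁅x⁆⇒-x⊆ {p = p} {q = q} {x = x} p⊆q+x y∈ with x∈p─q⁻ p ⁅ x ⁆ y∈
... | y∈p , y∉⁅x⁆ with x∈p∪q⁻ q ⁅ x ⁆ (p⊆q+x y∈p)
...   | inj₁ y∈q    = y∈q
...   | inj₂ y∈⁅x⁆ = ⊥-elim (y∉⁅x⁆ y∈⁅x⁆)

⊆-or-witness : ∀ (p q : Subset n) → p ⊆ q ⊎ ∃[ x ] x ∈ p × x ∉ q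
⊆-or-witness p q with nonempty? (p ─ q)
... | yes (x , x∈) = inj₂ (x , x∈p─q⁻ p q x∈)
... | no  p─q≡∅    = inj₁ p⊆q
  where
  p⊆q : p ⊆ q
  p⊆q {x} x∈p with x ∈? q
  ... | yes x∈q = x∈q
  ... | no  x∉q = ⊥-elim (p─q≡∅ (x , x∈p∧x∉q⇒x∈p─q x∈p x∉q))

⊆⇒⊇⊎⊂ : q ⊆ p → p ⊆ q ⊎ q ⊂ p
⊆⇒⊇⊎⊂ {q = q} {p = p} q⊆p with ⊆-or-witness p q
... | inj₁ p⊆q     = inj₁ p⊆q
... | inj₂ witness = inj₂ (q⊆p , witness)

≢⇒witness : p ≢ q → (∃[ x ] x ∈ p × x ∉ q) ⊎ (∃[ x ] x ∈ q × x ∉ p)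
≢⇒witness {p = p} {q = q} p≢q with ⊆-or-witness p q | ⊆-or-witness q p
... | inj₂ witness | _            = inj₁ witness
... | inj₁ _       | inj₂ witness = inj₂ witness
... | inj₁ p⊆q     | inj₁ q⊆p     = ⊥-elim (p≢q (⊆-antisym p⊆q q⊆p))

p─[p─q]≡q : q ⊆ p → p ─ (p ─ q) ≡ q
p─[p─q]≡q {q = q} {p = p} q⊆p = ⊆-antisym ⊆q (λ x∈q → x∈p∧x∉q⇒x∈p─q (q⊆p x∈q) (λ x∈p─q → proj₂ (x∈p─q⁻ p q x∈p─q) x∈q))
  where
  ⊆q : p ─ (p ─ q) ⊆ q
  ⊆q {x} x∈ with x∈p─q⁻ p (p ─ q) x∈ | x ∈? q
  ... | _         , _      | yes x∈q = x∈q
  ... | x∈p , x∉p─q | no x∉q  = ⊥-elim (x∉p─q (x∈p∧x∉q⇒x∈p─q x∈p x∉q))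

Disjoint : Subset n → Subset n → Set
Disjoint p q = ∀ {x} → x ∈ p → x ∉ q

⊆∪⇒Disjoint─ : p ⊆ q ∪ r → Disjoint (p ─ q) (p ─ r)
⊆∪⇒Disjoint─ {p = p} {q = q} {r = r} p⊆q∪r x∈p─q x∈p─r with x∈p─q⁻ p q x∈p─q
... | x∈p , x∉q with x∈p∪q⁻ q r (p⊆q∪r x∈p)
...   | inj₁ x∈q = x∉q x∈q
...   | inj₂ x∈r = proj₂ (x∈p─q⁻ p r x∈p─r) x∈r

Disjoint⇒∣p∪q∣≡∣p∣+∣q∣ : Disjoint p q → ∣ p ∪ q ∣ ≡ ∣ p ∣ + ∣ q ∣
Disjoint⇒∣p∪q∣≡∣p∣+∣q∣ {n} {p} {q} p#q = begin
  ∣ p ∪ q ∣                 ≡⟨ +-identityʳ _ ⟨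
  ∣ p ∪ q ∣ + 0             ≡⟨ cong (∣ p ∪ q ∣ +_) (∣⊥∣≡0 n) ⟨
  ∣ p ∪ q ∣ + ∣ ⊥ {n = n} ∣ ≡⟨ cong (λ s → ∣ p ∪ q ∣ + ∣ s ∣) p∩q≡⊥ ⟨
  ∣ p ∪ q ∣ + ∣ p ∩ q ∣     ≡⟨ ∣p∪q∣+∣p∩q∣≡∣p∣+∣q∣ p q ⟩
  ∣ p ∣ + ∣ q ∣             ∎
  where
  open ≡-Reasoning
  p∩q≡⊥ : p ∩ q ≡ ⊥
  p∩q≡⊥ = Empty-unique λ (x , x∈) → let (x∈p , x∈q) = x∈p∩q⁻ p q x∈ in p#q x∈p x∈q

x∈⋃⁻ : ∀ (ps : List (Subset n)) → x ∈ ⋃ ps → ∃[ p ] p ∈ₗ ps × x ∈ p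
x∈⋃⁻ []       x∈ = ⊥-elim (∉⊥ x∈)
x∈⋃⁻ (p ∷ ps) x∈ with x∈p∪q⁻ p (⋃ ps) x∈
... | inj₁ x∈p = p , here refl , x∈p
... | inj₂ x∈⋃ = let (q , q∈ , x∈q) = x∈⋃⁻ ps x∈⋃ in q , there q∈ , x∈q

x∈⋃⁺ : ∀ (ps : List (Subset n)) → p ∈ₗ ps → x ∈ p → x ∈ ⋃ ps
x∈⋃⁺ (q ∷ ps) (here refl) x∈p = x∈p∪q⁺ (inj₁ x∈p)
x∈⋃⁺ (q ∷ ps) (there p∈)  x∈p = x∈p∪q⁺ (inj₂ (x∈⋃⁺ ps p∈ x∈p))

x∈⋂⁻ : ∀ (ps : List (Subset n)) → x ∈ ⋂ ps → p ∈ₗ ps → x ∈ p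
x∈⋂⁻ (q ∷ ps) x∈ (here refl) = proj₁ (x∈p∩q⁻ q _ x∈)
x∈⋂⁻ (q ∷ ps) x∈ (there p∈)  = x∈⋂⁻ ps (proj₂ (x∈p∩q⁻ q _ x∈)) p∈

p─q∪p─r≡p─q∩r : ∀ (p q r : Subset n) → (p ─ q) ∪ (p ─ r) ≡ p ─ (q ∩ r)
p─q∪p─r≡p─q∩r p q r = ⊆-antisym ⊆-─∩ ⊇-─∩
  where
  ⊆-─∩ : (p ─ q) ∪ (p ─ r) ⊆ p ─ (q ∩ r)
  ⊆-─∩ x∈ with x∈p∪q⁻ (p ─ q) (p ─ r) x∈
  ... | inj₁ x∈p─q = let (x∈p , x∉q) = x∈p─q⁻ p q x∈p─q in
                     x∈p∧x∉q⇒x∈p─q x∈p (x∉q ∘ proj₁ ∘ x∈p∩q⁻ q r)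
  ... | inj₂ x∈p─r = let (x∈p , x∉r) = x∈p─q⁻ p r x∈p─r in
                     x∈p∧x∉q⇒x∈p─q x∈p (x∉r ∘ proj₂ ∘ x∈p∩q⁻ q r)
  ⊇-─∩ : p ─ (q ∩ r) ⊆ (p ─ q) ∪ (p ─ r)
  ⊇-─∩ {x} x∈ with x∈p─q⁻ p (q ∩ r) x∈ | x ∈? q
  ... | x∈p , _     | no  x∉q = x∈p∪q⁺ (inj₁ (x∈p∧x∉q⇒x∈p─q x∈p x∉q))
  ... | x∈p , x∉q∩r | yes x∈q = x∈p∪q⁺ (inj₂ (x∈p∧x∉q⇒x∈p─q x∈p λ x∈r → x∉q∩r (x∈p∩q⁺ (x∈q , x∈r))))

⋃[p─qs]≡p─⋂qs : ∀ (p : Subset n) qs → ⋃ (map (p ─_) qs) ≡ p ─ ⋂ qs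
⋃[p─qs]≡p─⋂qs p []       = sym (p─⊤≡⊥ p)
⋃[p─qs]≡p─⋂qs p (q ∷ qs) = trans (cong ((p ─ q) ∪_) (⋃[p─qs]≡p─⋂qs p qs)) (p─q∪p─r≡p─q∩r p q (⋂ qs))

∣⋃∣≡sum : ∀ {A : Set} (f : A → Subset n) {xs : List A} → Unique xs →
          (∀ {x y} → x ∈ₗ xs → y ∈ₗ xs → x ≢ y → Disjoint (f x) (f y)) →
          ∣ ⋃ (map f xs) ∣ ≡ sum (map (λ x → ∣ f x ∣) xs)
∣⋃∣≡sum {n} f {[]}     []           _        = ∣⊥∣≡0 n
∣⋃∣≡sum {n} f {x ∷ xs} (x∉xs ∷ uniq) disjoint =
  trans (Disjoint⇒∣p∪q∣≡∣p∣+∣q∣ fx#⋃) (cong (∣ f x ∣ +_) (∣⋃∣≡sum f uniq λ y∈ z∈ → disjoint (there y∈) (there z∈)))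
  where
  fx#⋃ : Disjoint (f x) (⋃ (map f xs))
  fx#⋃ z∈fx z∈⋃ with x∈⋃⁻ (map f xs) z∈⋃
  ... | _ , p∈ , z∈p with ∈-map⁻ f p∈
  ...   | y , y∈ , refl = disjoint (here refl) (there y∈) (All.lookup x∉xs y∈) z∈fx z∈p

sum-map-affine : ∀ {A : Set} (a : ℕ) (g h : A → ℕ) (xs : List A) → All (λ x → g x ≡ a * h x + 1) xs →
                 sum (map g xs) ≡ a * sum (map h xs) + length xs
sum-map-affine a g h []       []             = cong (_+ 0) (sym (*-zeroʳ a))
sum-map-affine a g h (x ∷ xs) (gx≡ ∷ gxs≡) = begin
  g x + sum (map g xs)                                ≡⟨ cong₂ _+_ gx≡ (sum-map-affine a g h xs gxs≡) ⟩
  (a * h x + 1) + (a * sum (map h xs) + length xs)    ≡⟨ interchange (a * h x) 1 _ _ ⟩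
  (a * h x + a * sum (map h xs)) + (1 + length xs)    ≡⟨ cong (_+ suc (length xs)) (*-distribˡ-+ a (h x) _) ⟨
  a * (h x + sum (map h xs)) + suc (length xs)        ∎
  where open ≡-Reasoning

∈-tabulate-does⁻ : ∀ {P : Pred (Fin n) 0ℓ} (P? : Decidable P) → x ∈ tabulate (λ y → does (P? y)) → P x
∈-tabulate-does⁻ {x = x} P? x∈ with P? x | trans (sym (lookup∘tabulate (λ y → does (P? y)) x)) ([]=⇒lookup x∈)
... | yes Px | _ = Px
... | no  _  | ()

∈-tabulate-does⁺ : ∀ {P : Pred (Fin n) 0ℓ} (P? : Decidable P) → P x → x ∈ tabulate (λ y → does (P? y))
∈-tabulate-does⁺ {x = x} P? Px = lookup⇒[]= x _ (trans (lookup∘tabulate (λ y → does (P? y)) x) (dec-true (P? x) Px))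

-- Enumeration of subsets

allSubsets-complete : ∀ (p : Subset m) → p ∈ₗ allSubsets m
allSubsets-complete []            = here refl
allSubsets-complete (outside ∷ p) = ∈-++⁺ˡ (∈-map⁺ (outside ∷_) (allSubsets-complete p))
allSubsets-complete (inside ∷ p)  =
  ∈-++⁺ʳ (map (outside ∷_) (allSubsets _)) (∈-map⁺ (inside ∷_) (allSubsets-complete p))

maxℕ-upper : ∀ {x xs} → x ∈ₗ xs → x ≤ maxℕ xs
maxℕ-upper (here refl)          = m≤m⊔n _ _
maxℕ-upper {xs = y ∷ _} (there x∈) = ≤-trans (maxℕ-upper x∈) (m≤n⊔m y _)

maxℕ-attained : ∀ xs → maxℕ xs ≡ 0 ⊎ maxℕ xs ∈ₗ xs
maxℕ-attained []       = inj₁ refl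
maxℕ-attained (x ∷ xs) with ⊔-sel x (maxℕ xs) | maxℕ-attained xs
... | inj₁ ≡x | _         = inj₂ (here ≡x)
... | inj₂ ≡m | inj₁ m≡0  = inj₁ (trans ≡m m≡0)
... | inj₂ ≡m | inj₂ m∈xs = inj₂ (there (subst (_∈ₗ xs) (sym ≡m) m∈xs))

allSubsets-unique : ∀ m → Unique (allSubsets m)
allSubsets-unique zero    = [] ∷ []
allSubsets-unique (suc m) = Unique.++⁺ (Unique.map⁺ ∷-injectiveʳ (allSubsets-unique m))
                                       (Unique.map⁺ ∷-injectiveʳ (allSubsets-unique m)) outside∷≢inside∷
  where
  outside∷≢inside∷ : ∀ {p} → ¬ (p ∈ₗ map (outside ∷_) (allSubsets m) × p ∈ₗ map (inside ∷_) (allSubsets m))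
  outside∷≢inside∷ (p∈₁ , p∈₂) with ∈-map⁻ (outside ∷_) p∈₁ | ∈-map⁻ (inside ∷_) p∈₂
  ... | _ , _ , refl | _ , _ , ()

module _ {m : ℕ} (r : Subset m → ℕ) where
  open MatroidNotions r

  private
    subCircuit? : ∀ k D → Decidable (λ B → B ⊆ D × FoldCircuit (k ∸ 1) B)
    subCircuit? k D B = (B ⊆? D) ×-dec foldCircuit? (k ∸ 1) B

  ∈subCircuits⁻ : ∀ {k D B} → B ∈ₗ subCircuits k D → B ⊆ D × FoldCircuit (k ∸ 1) B
  ∈subCircuits⁻ {k} {D} B∈ = proj₂ (∈-filter⁻ (subCircuit? k D) {xs = allSubsets m} B∈)

  ∈subCircuits⁺ : ∀ {k D B} → B ⊆ D → FoldCircuit (k ∸ 1) B → B ∈ₗ subCircuits k D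
  ∈subCircuits⁺ {k} {D} {B} B⊆D B-circuit = ∈-filter⁺ (subCircuit? k D) (allSubsets-complete B) (B⊆D , B-circuit)

  subCircuits-unique : ∀ k D → Unique (subCircuits k D)
  subCircuits-unique k D = Unique.filter⁺ (subCircuit? k D) (allSubsets-unique m)

-- The count matroid M_{a,0}(H)

module CountMatroidProperties (a : ℕ) {{a≢0 : NonZero a}} (H : Multigraph) where
  open Multigraph H
  open CountMatroid a 0 H

  Ends : Fin nE → Subset nV
  Ends e = ⁅ proj₁ (ends e) ⁆ ∪ ⁅ proj₂ (ends e) ⁆

  v : Subset nE → ℕ
  v X = ∣ V X ∣

  private
    variable
      j : ℕ
      B B₁ B₂ D I J T X Y Z : Subset nE
      e : Fin nE
      U : Subset nV
      w : Fin nV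

  ∈V⁻ : w ∈ V X → ∃[ e ] e ∈ X × w ∈ Ends e
  ∈V⁻ {X = X} w∈ with x∈⋃⁻ (map Ends (filter (_∈? X) (allFin nE))) w∈
  ... | _ , E∈ , w∈E with ∈-map⁻ Ends E∈
  ...   | e , e∈ , refl = e , proj₂ (∈-filter⁻ (_∈? X) {xs = allFin nE} e∈) , w∈E

  ∈V⁺ : e ∈ X → w ∈ Ends e → w ∈ V X
  ∈V⁺ {e = e} {X = X} e∈X w∈ =
    x∈⋃⁺ (map Ends (filter (_∈? X) (allFin nE))) (∈-map⁺ Ends (∈-filter⁺ (_∈? X) (∈-allFin e) e∈X)) w∈

  V-mono : X ⊆ Y → V X ⊆ V Y
  V-mono X⊆Y w∈ = let (e , e∈X , w∈e) = ∈V⁻ w∈ in ∈V⁺ (X⊆Y e∈X) w∈e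

  v-mono : X ⊆ Y → v X ≤ v Y
  v-mono X⊆Y = p⊆q⇒∣p∣≤∣q∣ (V-mono X⊆Y)

  V-∪ : ∀ X Y → V (X ∪ Y) ⊆ V X ∪ V Y
  V-∪ X Y w∈ with ∈V⁻ w∈
  ... | e , e∈ , w∈e with x∈p∪q⁻ X Y e∈
  ...   | inj₁ e∈X = x∈p∪q⁺ (inj₁ (∈V⁺ e∈X w∈e))
  ...   | inj₂ e∈Y = x∈p∪q⁺ (inj₂ (∈V⁺ e∈Y w∈e))

  v-submodular : ∀ X Y → v (X ∪ Y) + v (X ∩ Y) ≤ v X + v Y
  v-submodular X Y = begin
    v (X ∪ Y) + v (X ∩ Y)           ≤⟨ +-mono-≤ (p⊆q⇒∣p∣≤∣q∣ (V-∪ X Y)) (p⊆q⇒∣p∣≤∣q∣ V∩⊆) ⟩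
    ∣ V X ∪ V Y ∣ + ∣ V X ∩ V Y ∣    ≡⟨ ∣p∪q∣+∣p∩q∣≡∣p∣+∣q∣ (V X) (V Y) ⟩
    v X + v Y                        ∎
    where
    open ≤-Reasoning
    V∩⊆ : V (X ∩ Y) ⊆ V X ∩ V Y
    V∩⊆ w∈ = x∈p∩q⁺ (V-mono (p∩q⊆p X Y) w∈ , V-mono (p∩q⊆q X Y) w∈)

  v⊥≡0 : v ⊥ ≡ 0
  v⊥≡0 = trans (cong ∣_∣ (Empty-unique λ (w , w∈) → ∉⊥ (proj₁ (proj₂ (∈V⁻ w∈))))) (∣⊥∣≡0 nV)

  independent⇒∣J∣≤a*v : Independent I → J ⊆ I → ∣ J ∣ ≤ a * v J
  independent⇒∣J∣≤a*v {J = J} indI J⊆I with nonempty? J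
  ... | yes J≢∅ = subst (_≤ a * v J) (+-identityʳ _) (indI J J⊆I J≢∅)
  ... | no  J≡∅ = subst (_≤ a * v J) (sym (trans (cong ∣_∣ (Empty-unique J≡∅)) (∣⊥∣≡0 nE))) z≤n

  ¬independent⇒violation : ¬ Independent J → ∃[ F ] F ⊆ J × a * v F < ∣ F ∣
  ¬independent⇒violation {J} dep with anySubset? (λ F → (F ⊆? J) ×-dec (a * v F <? ∣ F ∣))
  ... | yes violation = violation
  ... | no  none      = ⊥-elim (dep λ F F⊆J _ →
    subst (_≤ a * v F) (sym (+-identityʳ _)) (≮⇒≥ λ a*vF<∣F∣ → none (F , F⊆J , a*vF<∣F∣)))

  Basis : Subset nE → Subset nE → Set
  Basis X I = I ⊆ X × Independent I × ∣ I ∣ ≡ rank X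

  ∣I∣≤rank : I ⊆ X → Independent I → ∣ I ∣ ≤ rank X
  ∣I∣≤rank {I} {X} I⊆X indI =
    maxℕ-upper (∈-map⁺ ∣_∣ (∈-filter⁺ (λ I → (I ⊆? X) ×-dec independent? I) (allSubsets-complete I) (I⊆X , indI)))

  basis : ∀ X → ∃ (Basis X)
  basis X with maxℕ-attained (map ∣_∣ (filter (λ I → (I ⊆? X) ×-dec independent? I) (allSubsets nE)))
  ... | inj₁ r≡0 = ⊥ , (λ x∈ → ⊥-elim (∉⊥ x∈)) , (λ F F⊆⊥ (x , x∈F) → ⊥-elim (∉⊥ (F⊆⊥ x∈F))) ,
                   trans (∣⊥∣≡0 nE) (sym r≡0)
  ... | inj₂ r∈ with ∈-map⁻ ∣_∣ r∈
  ...   | I , I∈ , r≡∣I∣ with ∈-filter⁻ (λ I → (I ⊆? X) ×-dec independent? I) {xs = allSubsets nE} I∈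
  ...     | _ , I⊆X , indI = I , I⊆X , indI , sym r≡∣I∣

  rank-mono : X ⊆ Y → rank X ≤ rank Y
  rank-mono X⊆Y with basis _
  ... | I , I⊆X , indI , ∣I∣≡r = subst (_≤ _) ∣I∣≡r (∣I∣≤rank (⊆-trans I⊆X X⊆Y) indI)

  rank≤a*v : ∀ X → rank X ≤ a * v X
  rank≤a*v X with basis X
  ... | I , I⊆X , indI , ∣I∣≡r =
    subst (_≤ a * v X) ∣I∣≡r (≤-trans (independent⇒∣J∣≤a*v indI ⊆-refl) (*-monoʳ-≤ a (v-mono I⊆X)))

  basis-maximal : Basis X I → e ∈ X → e ∉ I → ¬ Independent (I ∪ ⁅ e ⁆)
  basis-maximal {X} {I} {e} (I⊆X , _ , ∣I∣≡r) e∈X e∉I indI+e = <⇒≱ ∣I∣<∣I+e∣ (begin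
    ∣ I ∪ ⁅ e ⁆ ∣ ≤⟨ ∣I∣≤rank (∪-least I⊆X (λ x∈ → subst (_∈ X) (sym (x∈⁅y⁆⇒x≡y e x∈)) e∈X)) indI+e ⟩
    rank X       ≡⟨ ∣I∣≡r ⟨
    ∣ I ∣        ∎)
    where
    open ≤-Reasoning
    ∣I∣<∣I+e∣ : ∣ I ∣ < ∣ I ∪ ⁅ e ⁆ ∣
    ∣I∣<∣I+e∣ = p⊂q⇒∣p∣<∣q∣ (p⊆p∪q ⁅ e ⁆ , e , q⊆p∪q I ⁅ e ⁆ (x∈⁅x⁆ e) , e∉I)

  cost : Subset nE → Subset nE → ℕ
  cost X Y = ∣ X ─ Y ∣ + a * v Y

  cost+∣Y∣ : Y ⊆ X → cost X Y + ∣ Y ∣ ≡ ∣ X ∣ + a * v Y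
  cost+∣Y∣ {Y} {X} Y⊆X = begin
    ∣ X ─ Y ∣ + a * v Y + ∣ Y ∣ ≡⟨ +-assoc ∣ X ─ Y ∣ _ _ ⟩
    ∣ X ─ Y ∣ + (a * v Y + ∣ Y ∣) ≡⟨ cong (∣ X ─ Y ∣ +_) (+-comm (a * v Y) ∣ Y ∣) ⟩
    ∣ X ─ Y ∣ + (∣ Y ∣ + a * v Y) ≡⟨ +-assoc ∣ X ─ Y ∣ _ _ ⟨
    ∣ X ─ Y ∣ + ∣ Y ∣ + a * v Y ≡⟨ cong (_+ a * v Y) (q⊆p⇒∣p─q∣+∣q∣≡∣p∣ Y⊆X) ⟩
    ∣ X ∣ + a * v Y ∎
    where open ≡-Reasoning

  rank≤cost : ∀ X Y → rank X ≤ cost X Y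
  rank≤cost X Y with basis X
  ... | I , I⊆X , indI , ∣I∣≡r = begin
    rank X                       ≡⟨ ∣I∣≡r ⟨
    ∣ I ∣                        ≡⟨ ∣p─q∣+∣p∩q∣≡∣p∣ I Y ⟨
    ∣ I ─ Y ∣ + ∣ I ∩ Y ∣        ≤⟨ +-mono-≤ (p⊆q⇒∣p∣≤∣q∣ I─Y⊆X─Y) (independent⇒∣J∣≤a*v indI (p∩q⊆p I Y)) ⟩
    ∣ X ─ Y ∣ + a * v (I ∩ Y)    ≤⟨ +-monoʳ-≤ ∣ X ─ Y ∣ (*-monoʳ-≤ a (v-mono (p∩q⊆q I Y))) ⟩
    cost X Y                     ∎
    where
    open ≤-Reasoning
    I─Y⊆X─Y : I ─ Y ⊆ X ─ Y
    I─Y⊆X─Y x∈ = let (x∈I , x∉Y) = x∈p─q⁻ I Y x∈ in x∈p∧x∉q⇒x∈p─q (I⊆X x∈I) x∉Y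

  TightIn : Subset nE → Subset nE → Set
  TightIn I T = T ⊆ I × a * v T ≤ ∣ T ∣

  tight-⊥ : TightIn I ⊥
  tight-⊥ = (λ x∈ → ⊥-elim (∉⊥ x∈)) , subst (_≤ ∣ ⊥ {n = nE} ∣) (sym (trans (cong (a *_) v⊥≡0) (*-zeroʳ a))) z≤n

  tight-∪ : ∀ {T₁ T₂} → Independent I → TightIn I T₁ → TightIn I T₂ → TightIn I (T₁ ∪ T₂)
  tight-∪ {T₁ = T₁} {T₂} indI (T₁⊆I , t₁) (T₂⊆I , t₂) = ∪-least T₁⊆I T₂⊆I , +-cancelʳ-≤ (a * v (T₁ ∩ T₂)) _ _ (begin
    a * v (T₁ ∪ T₂) + a * v (T₁ ∩ T₂) ≡⟨ *-distribˡ-+ a _ _ ⟨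
    a * (v (T₁ ∪ T₂) + v (T₁ ∩ T₂))   ≤⟨ *-monoʳ-≤ a (v-submodular T₁ T₂) ⟩
    a * (v T₁ + v T₂)                 ≡⟨ *-distribˡ-+ a _ _ ⟩
    a * v T₁ + a * v T₂               ≤⟨ +-mono-≤ t₁ t₂ ⟩
    ∣ T₁ ∣ + ∣ T₂ ∣                   ≡⟨ ∣p∪q∣+∣p∩q∣≡∣p∣+∣q∣ T₁ T₂ ⟨
    ∣ T₁ ∪ T₂ ∣ + ∣ T₁ ∩ T₂ ∣         ≤⟨ +-monoʳ-≤ _ (independent⇒∣J∣≤a*v indI (⊆-trans (p∩q⊆p T₁ T₂) T₁⊆I)) ⟩
    ∣ T₁ ∪ T₂ ∣ + a * v (T₁ ∩ T₂)     ∎)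
    where open ≤-Reasoning

  dependentExtension⇒tight : Independent I → e ∉ I → ¬ Independent (I ∪ ⁅ e ⁆) →
                             ∃[ T ] TightIn I T × Ends e ⊆ V T
  dependentExtension⇒tight {I} {e} indI e∉I dep with ¬independent⇒violation dep
  ... | F , F⊆I+e , a*vF<∣F∣ with e ∈? F
  ...   | no e∉F = ⊥-elim (<⇒≱ a*vF<∣F∣ (independent⇒∣J∣≤a*v indI F⊆I))
    where
    F⊆I : F ⊆ I
    F⊆I x∈F = ⊆∪⁅x⁆⇒-x⊆ F⊆I+e (x∈p∧x≢y⇒x∈p-y x∈F λ { refl → e∉F x∈F })
  ...   | yes e∈F = F - e , (F-e⊆I , ≤-trans (*-monoʳ-≤ a (v-mono (p─q⊆p F ⁅ e ⁆))) a*vF≤∣F-e∣) , Ends⊆V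
    where
    F-e⊆I : F - e ⊆ I
    F-e⊆I = ⊆∪⁅x⁆⇒-x⊆ F⊆I+e
    a*vF≤∣F-e∣ : a * v F ≤ ∣ F - e ∣
    a*vF≤∣F-e∣ = ≤-pred (subst (a * v F <_) (x∈p⇒∣p∣≡1+∣p-x∣ e∈F) a*vF<∣F∣)
    Ends⊆V : Ends e ⊆ V (F - e)
    Ends⊆V {w} w∈e with w ∈? V (F - e)
    ... | yes w∈V = w∈V
    ... | no  w∉V = ⊥-elim (<⇒≱ (*-monoʳ-< a v<v)
                                 (≤-trans a*vF≤∣F-e∣ (independent⇒∣J∣≤a*v indI F-e⊆I)))
      where
      v<v : v (F - e) < v F
      v<v = p⊂q⇒∣p∣<∣q∣ (V-mono (p─q⊆p F ⁅ e ⁆) , w , ∈V⁺ e∈F w∈e , w∉V)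

  tightCover : Independent I → (es : List (Fin nE)) →
               (∀ {e} → e ∈ₗ es → ∃[ T ] TightIn I T × Ends e ⊆ V T) →
               ∃[ T ] TightIn I T × (∀ {e} → e ∈ₗ es → Ends e ⊆ V T)
  tightCover indI []       _         = ⊥ , tight-⊥ , λ ()
  tightCover indI (e ∷ es) tightFor with tightFor (here refl) | tightCover indI es (tightFor ∘ there)
  ... | T₁ , t₁ , covers₁ | T₂ , t₂ , covers₂ = T₁ ∪ T₂ , tight-∪ indI t₁ t₂ , λ where
    (here refl) → ⊆-trans covers₁ (V-mono (p⊆p∪q T₂))
    (there e∈)  → ⊆-trans (covers₂ e∈) (V-mono (q⊆p∪q T₁ T₂))

  basis-tightCover : Basis X I → ∃[ T ] TightIn I T × (∀ {e} → e ∈ X ─ I → Ends e ⊆ V T)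
  basis-tightCover {X} {I} B@(_ , indI , _) =
    let (T , t , covers) = tightCover indI (filter (_∈? X ─ I) (allFin nE)) fundamental
    in T , t , λ e∈ → covers (∈-filter⁺ (_∈? X ─ I) (∈-allFin _) e∈)
    where
    fundamental : ∀ {e} → e ∈ₗ filter (_∈? X ─ I) (allFin nE) → ∃[ T ] TightIn I T × Ends e ⊆ V T
    fundamental e∈ with x∈p─q⁻ X I (proj₂ (∈-filter⁻ (_∈? X ─ I) {xs = allFin nE} e∈))
    ... | e∈X , e∉I = dependentExtension⇒tight indI e∉I (basis-maximal B e∈X e∉I)

  Minimiser : Subset nE → Subset nE → Set
  Minimiser X Y = Y ⊆ X × cost X Y ≤ rank X

  -- The minimum of cost X is attained at T ∪ (X ─ I), for a basis I of X and a tight T ⊆ I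
  -- spanning the ends of all edges of X ─ I.
  cost-minimiser : ∀ X → ∃ (Minimiser X)
  cost-minimiser X with basis X
  ... | I , B@(I⊆X , _ , ∣I∣≡r) with basis-tightCover B
  ...   | T , (T⊆I , a*vT≤∣T∣) , covers = Y* , ∪-least (⊆-trans T⊆I I⊆X) (p─q⊆p X I) , (begin
    ∣ X ─ Y* ∣ + a * v Y* ≤⟨ +-mono-≤ (p⊆q⇒∣p∣≤∣q∣ X─Y⊆I─T) (*-monoʳ-≤ a (p⊆q⇒∣p∣≤∣q∣ VY⊆VT)) ⟩
    ∣ I ─ T ∣ + a * v T ≤⟨ +-monoʳ-≤ ∣ I ─ T ∣ a*vT≤∣T∣ ⟩
    ∣ I ─ T ∣ + ∣ T ∣   ≡⟨ q⊆p⇒∣p─q∣+∣q∣≡∣p∣ T⊆I ⟩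
    ∣ I ∣               ≡⟨ ∣I∣≡r ⟩
    rank X              ∎)
    where
    open ≤-Reasoning
    Y* : Subset nE
    Y* = T ∪ (X ─ I)
    X─Y⊆I─T : X ─ Y* ⊆ I ─ T
    X─Y⊆I─T {x} x∈ with x∈p─q⁻ X Y* x∈ | x ∈? I
    ... | _   , x∉Y | yes x∈I = x∈p∧x∉q⇒x∈p─q x∈I (x∉Y ∘ p⊆p∪q (X ─ I))
    ... | x∈X , x∉Y | no  x∉I = ⊥-elim (x∉Y (q⊆p∪q T (X ─ I) (x∈p∧x∉q⇒x∈p─q x∈X x∉I)))
    VY⊆VT : V Y* ⊆ V T
    VY⊆VT w∈ with x∈p∪q⁻ (V T) (V (X ─ I)) (V-∪ T (X ─ I) w∈)
    ... | inj₁ w∈T = w∈T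
    ... | inj₂ w∈V with ∈V⁻ w∈V
    ...   | e , e∈ , w∈e = covers e∈ w∈e

  minimiser-⊇ : Minimiser X Y → Z ⊆ Y → a * v Z ≤ rank X
  minimiser-⊇ {X} {Y} {Z} (_ , cost≤r) Z⊆Y = begin
    a * v Z  ≤⟨ *-monoʳ-≤ a (v-mono Z⊆Y) ⟩
    a * v Y  ≤⟨ m≤n+m (a * v Y) ∣ X ─ Y ∣ ⟩
    cost X Y ≤⟨ cost≤r ⟩
    rank X   ∎
    where open ≤-Reasoning

  minimiser-+ : Minimiser X Y → ∣ X ∣ + a * v Y ≤ rank X + ∣ Y ∣
  minimiser-+ {X} {Y} (Y⊆X , cost≤r) = subst (_≤ rank X + ∣ Y ∣) (cost+∣Y∣ Y⊆X) (+-monoˡ-≤ ∣ Y ∣ cost≤r)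

  open MatroidNotions rank

  cyclic-rank-drop : Cyclic D → Y ⊂ D → rank D + ∣ Y ∣ < ∣ D ∣ + a * v Y
  cyclic-rank-drop {D} {Y} cyc (Y⊆D , e , e∈D , e∉Y) = begin-strict
    rank D + ∣ Y ∣         ≡⟨ cong (_+ ∣ Y ∣) (cyc e e∈D) ⟨
    rank (D - e) + ∣ Y ∣   ≤⟨ +-monoˡ-≤ ∣ Y ∣ (rank≤cost (D - e) Y) ⟩
    cost (D - e) Y + ∣ Y ∣ ≡⟨ cost+∣Y∣ Y⊆D-e ⟩
    ∣ D - e ∣ + a * v Y    <⟨ +-monoˡ-< (a * v Y) (x∈p⇒∣p-x∣<∣p∣ e∈D) ⟩
    ∣ D ∣ + a * v Y        ∎
    where
    open ≤-Reasoning
    Y⊆D-e : Y ⊆ D - e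
    Y⊆D-e x∈Y = x∈p∧x≢y⇒x∈p-y (Y⊆D x∈Y) λ { refl → e∉Y x∈Y }

  a*v≤rank⊎properDeficit : X ⊆ Z → a * v Z ≤ rank X ⊎ ∃[ Y ] Y ⊂ Z × ∣ X ∣ + a * v Y ≤ rank X + ∣ Y ∣
  a*v≤rank⊎properDeficit {X} {Z} X⊆Z = fromMinimiser (cost-minimiser X)
    where
    fromMinimiser : ∃ (Minimiser X) → a * v Z ≤ rank X ⊎ ∃[ Y ] Y ⊂ Z × ∣ X ∣ + a * v Y ≤ rank X + ∣ Y ∣
    fromMinimiser (Y , min) with ⊆⇒⊇⊎⊂ (⊆-trans (proj₁ min) X⊆Z)
    ... | inj₁ Z⊆Y = inj₁ (minimiser-⊇ min Z⊆Y)
    ... | inj₂ Y⊂Z = inj₂ (Y , Y⊂Z , minimiser-+ min)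

  cyclic⇒rank≡a*v : Cyclic D → rank D ≡ a * v D
  cyclic⇒rank≡a*v {D} cyc =
    [ ≤-antisym (rank≤a*v D)
    , (λ (Y , Y⊂D , deficit) → ⊥-elim (<⇒≱ (cyclic-rank-drop cyc Y⊂D) deficit))
    ]′ (a*v≤rank⊎properDeficit ⊆-refl)

  HasExcess : ℕ → Subset nE → Set
  HasExcess j Z = ∣ Z ∣ ≡ a * v Z + j

  ProperSubsetsExcessBelow : ℕ → Subset nE → Set
  ProperSubsetsExcessBelow j Z = ∀ {Y} → Y ⊂ Z → ∣ Y ∣ < a * v Y + j

  properSubset-excess≤ : ProperSubsetsExcessBelow (suc j) Z → Y ⊂ Z → ∣ Y ∣ ≤ a * v Y + j
  properSubset-excess≤ {Y = Y} below Y⊂Z = ≤-pred (subst (∣ Y ∣ <_) (+-suc _ _) (below Y⊂Z))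

  foldCircuit⇒excess : FoldCircuit j Z → HasExcess j Z × ProperSubsetsExcessBelow j Z
  foldCircuit⇒excess {j} {Z} (cyc , r+j≡∣Z∣) = ∣Z∣≡ , below
    where
    ∣Z∣≡ : HasExcess j Z
    ∣Z∣≡ = trans (sym r+j≡∣Z∣) (cong (_+ j) (cyclic⇒rank≡a*v cyc))
    below : ProperSubsetsExcessBelow j Z
    below {Y} Y⊂Z = +-cancelˡ-< (rank Z) _ _ (begin-strict
      rank Z + ∣ Y ∣         <⟨ cyclic-rank-drop cyc Y⊂Z ⟩
      ∣ Z ∣ + a * v Y        ≡⟨ cong (_+ a * v Y) r+j≡∣Z∣ ⟨
      rank Z + j + a * v Y   ≡⟨ +-assoc (rank Z) j _ ⟩
      rank Z + (j + a * v Y) ≡⟨ cong (rank Z +_) (+-comm j _) ⟩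
      rank Z + (a * v Y + j) ∎)
      where open ≤-Reasoning

  excess⇒a*v≤rank : HasExcess j Z → ProperSubsetsExcessBelow j Z → X ⊆ Z → ∣ Z ∣ ≤ suc ∣ X ∣ → a * v Z ≤ rank X
  excess⇒a*v≤rank {j} {Z} {X} ∣Z∣≡ below X⊆Z ∣Z∣≤1+∣X∣ = [ (λ a*v≤r → a*v≤r) , fromDeficit ]′ (a*v≤rank⊎properDeficit X⊆Z)
    where
    fromDeficit : ∃[ Y ] Y ⊂ Z × ∣ X ∣ + a * v Y ≤ rank X + ∣ Y ∣ → a * v Z ≤ rank X
    fromDeficit (Y , Y⊂Z , deficit) = +-cancelʳ-≤ (a * v Y + j) _ _ (begin
      a * v Z + (a * v Y + j) ≡⟨ cong (a * v Z +_) (+-comm (a * v Y) j) ⟩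
      a * v Z + (j + a * v Y) ≡⟨ +-assoc (a * v Z) j _ ⟨
      a * v Z + j + a * v Y   ≡⟨ cong (_+ a * v Y) ∣Z∣≡ ⟨
      ∣ Z ∣ + a * v Y         ≤⟨ +-monoˡ-≤ (a * v Y) ∣Z∣≤1+∣X∣ ⟩
      suc (∣ X ∣ + a * v Y)   ≤⟨ s≤s deficit ⟩
      suc (rank X + ∣ Y ∣)    ≡⟨ +-suc (rank X) ∣ Y ∣ ⟨
      rank X + suc ∣ Y ∣      ≤⟨ +-monoʳ-≤ (rank X) (below Y⊂Z) ⟩
      rank X + (a * v Y + j)  ∎)
      where open ≤-Reasoning

  excess⇒foldCircuit : HasExcess j Z → ProperSubsetsExcessBelow j Z → FoldCircuit j Z
  excess⇒foldCircuit {j} {Z} ∣Z∣≡ below = cyclic , trans (cong (_+ j) r≡a*v) (sym ∣Z∣≡)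
    where
    r≡a*v : rank Z ≡ a * v Z
    r≡a*v = ≤-antisym (rank≤a*v Z) (excess⇒a*v≤rank ∣Z∣≡ below ⊆-refl (n≤1+n ∣ Z ∣))
    cyclic : Cyclic Z
    cyclic e e∈Z = ≤-antisym (rank-mono (p─q⊆p Z ⁅ e ⁆)) (subst (_≤ rank (Z - e)) (sym r≡a*v)
      (excess⇒a*v≤rank ∣Z∣≡ below (p─q⊆p Z ⁅ e ⁆) (≤-reflexive (x∈p⇒∣p∣≡1+∣p-x∣ e∈Z))))

  minimalExcessSubset : ∀ Z → a * v Z + j ≤ ∣ Z ∣ →
                        ∃[ B ] B ⊆ Z × a * v B + j ≤ ∣ B ∣ × ProperSubsetsExcessBelow j B
  minimalExcessSubset {j} Z = descend Z (On.wellFounded ∣_∣ <-wellFounded Z)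
    where
    descend : ∀ Z → Acc (_<_ on ∣_∣) Z → a * v Z + j ≤ ∣ Z ∣ →
              ∃[ B ] B ⊆ Z × a * v B + j ≤ ∣ B ∣ × ProperSubsetsExcessBelow j B
    descend Z (acc smaller) excess with anySubset? (λ Y → (Y ⊂? Z) ×-dec (a * v Y + j ≤? ∣ Y ∣))
    ... | yes (Y , Y⊂Z , excessY) =
      let (B , B⊆Y , minimal) = descend Y (smaller (p⊂q⇒∣p∣<∣q∣ Y⊂Z)) excessY
      in B , ⊆-trans B⊆Y (proj₁ Y⊂Z) , minimal
    ... | no ∄Y = Z , ⊆-refl , excess , λ Y⊂Z → ≰⇒> λ excessY → ∄Y (_ , Y⊂Z , excessY)

  subcircuitAvoiding : FoldCircuit (suc j) D → e ∈ D → ∃[ B ] B ⊆ D × e ∉ B × FoldCircuit j B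
  subcircuitAvoiding {j} {D} {e} D-circuit e∈D = fromMinimal (minimalExcessSubset (D - e) excessD-e)
    where
    ∣D∣≡ : HasExcess (suc j) D
    ∣D∣≡ = proj₁ (foldCircuit⇒excess D-circuit)
    excessD-e : a * v (D - e) + j ≤ ∣ D - e ∣
    excessD-e = begin
      a * v (D - e) + j ≤⟨ +-monoˡ-≤ j (*-monoʳ-≤ a (v-mono (p─q⊆p D ⁅ e ⁆))) ⟩
      a * v D + j       ≡⟨ suc-injective (trans (sym (+-suc _ j)) (trans (sym ∣D∣≡) (x∈p⇒∣p∣≡1+∣p-x∣ e∈D))) ⟩
      ∣ D - e ∣         ∎
      where open ≤-Reasoning
    fromMinimal : ∃[ B ] B ⊆ D - e × a * v B + j ≤ ∣ B ∣ × ProperSubsetsExcessBelow j B →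
                  ∃[ B ] B ⊆ D × e ∉ B × FoldCircuit j B
    fromMinimal (B , B⊆D-e , excessB , belowB) = B , B⊆D , e∉B ,
      excess⇒foldCircuit (≤-antisym (properSubset-excess≤ (proj₂ (foldCircuit⇒excess D-circuit)) B⊂D) excessB) belowB
      where
      B⊆D : B ⊆ D
      B⊆D = ⊆-trans B⊆D-e (p─q⊆p D ⁅ e ⁆)
      e∉B : e ∉ B
      e∉B e∈B = proj₂ (x∈p─q⁻ D ⁅ e ⁆ (B⊆D-e e∈B)) (x∈⁅x⁆ e)
      B⊂D : B ⊂ D
      B⊂D = B⊆D , e , e∈D , e∉B

  subcircuits-union-notProper : FoldCircuit (suc j) D → FoldCircuit j B₁ → FoldCircuit j B₂ →
                                ∃[ x ] x ∈ B₁ × x ∉ B₂ → ¬ (B₁ ∪ B₂ ⊂ D)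
  subcircuits-union-notProper {j} {D} {B₁} {B₂} D-circuit B₁-circuit B₂-circuit (x , x∈B₁ , x∉B₂) U⊂D =
    <-irrefl refl (begin-strict
    ∣ B₁ ∣ + ∣ B₂ ∣                   ≡⟨ ∣p∪q∣+∣p∩q∣≡∣p∣+∣q∣ B₁ B₂ ⟨
    ∣ B₁ ∪ B₂ ∣ + ∣ B₁ ∩ B₂ ∣         <⟨ +-mono-≤-< (properSubset-excess≤ belowD U⊂D) (below₁ N⊂B₁) ⟩
    (a * v (B₁ ∪ B₂) + j) + (a * v (B₁ ∩ B₂) + j) ≡⟨ interchange (a * v (B₁ ∪ B₂)) j (a * v (B₁ ∩ B₂)) j ⟩
    (a * v (B₁ ∪ B₂) + a * v (B₁ ∩ B₂)) + (j + j) ≡⟨ cong (_+ (j + j)) (*-distribˡ-+ a _ _) ⟨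
    a * (v (B₁ ∪ B₂) + v (B₁ ∩ B₂)) + (j + j)     ≤⟨ +-monoˡ-≤ (j + j) (*-monoʳ-≤ a (v-submodular B₁ B₂)) ⟩
    a * (v B₁ + v B₂) + (j + j)       ≡⟨ cong (_+ (j + j)) (*-distribˡ-+ a _ _) ⟩
    (a * v B₁ + a * v B₂) + (j + j)   ≡⟨ interchange (a * v B₁) (a * v B₂) j j ⟩
    (a * v B₁ + j) + (a * v B₂ + j)   ≡⟨ cong₂ _+_ ∣B₁∣≡ ∣B₂∣≡ ⟨
    ∣ B₁ ∣ + ∣ B₂ ∣                   ∎)
    where
    open ≤-Reasoning
    belowD : ProperSubsetsExcessBelow (suc j) D
    belowD = proj₂ (foldCircuit⇒excess D-circuit)
    ∣B₁∣≡ : HasExcess j B₁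
    ∣B₁∣≡ = proj₁ (foldCircuit⇒excess B₁-circuit)
    below₁ : ProperSubsetsExcessBelow j B₁
    below₁ = proj₂ (foldCircuit⇒excess B₁-circuit)
    ∣B₂∣≡ : HasExcess j B₂
    ∣B₂∣≡ = proj₁ (foldCircuit⇒excess B₂-circuit)
    N⊂B₁ : B₁ ∩ B₂ ⊂ B₁
    N⊂B₁ = p∩q⊆p B₁ B₂ , x , x∈B₁ , x∉B₂ ∘ proj₂ ∘ x∈p∩q⁻ B₁ B₂

  distinctSubcircuits-cover : FoldCircuit (suc j) D → B₁ ⊆ D × FoldCircuit j B₁ → B₂ ⊆ D × FoldCircuit j B₂ →
                              B₁ ≢ B₂ → D ⊆ B₁ ∪ B₂
  distinctSubcircuits-cover {D = D} {B₁} {B₂} D-circuit (B₁⊆D , B₁-circuit) (B₂⊆D , B₂-circuit) B₁≢B₂ {y} y∈D =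
    decidable-stable (y ∈? B₁ ∪ B₂) λ y∉U →
      [ (λ witness → subcircuits-union-notProper D-circuit B₁-circuit B₂-circuit witness (U⊂D y∉U))
      , (λ witness → subcircuits-union-notProper D-circuit B₂-circuit B₁-circuit witness
                       (subst (_⊂ D) (∪-comm B₁ B₂) (U⊂D y∉U)))
      ]′ (≢⇒witness B₁≢B₂)
    where
    U⊂D : y ∉ B₁ ∪ B₂ → B₁ ∪ B₂ ⊂ D
    U⊂D y∉U = ∪-least B₁⊆D B₂⊆D , y , y∈D , y∉U

  EdgesWithin : Subset nV → Subset nE
  EdgesWithin U = tabulate (λ e → does (Ends e ⊆? U))

  ∈EdgesWithin⁻ : e ∈ EdgesWithin U → Ends e ⊆ U
  ∈EdgesWithin⁻ {U = U} = ∈-tabulate-does⁻ (λ e → Ends e ⊆? U)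

  ∈EdgesWithin⁺ : Ends e ⊆ U → e ∈ EdgesWithin U
  ∈EdgesWithin⁺ {U = U} = ∈-tabulate-does⁺ (λ e → Ends e ⊆? U)

  V-EdgesWithin : V (EdgesWithin U) ⊆ U
  V-EdgesWithin w∈ = let (e , e∈ , w∈e) = ∈V⁻ w∈ in ∈EdgesWithin⁻ e∈ w∈e

  EdgesWithin-⊤ : EdgesWithin ⊤ ≡ ⊤
  EdgesWithin-⊤ = ⊆-antisym ⊆⊤ (λ _ → ∈EdgesWithin⁺ (λ _ → ∈⊤))

  EdgesWithin-∩ : ∀ W₁ W₂ → EdgesWithin (W₁ ∩ W₂) ≡ EdgesWithin W₁ ∩ EdgesWithin W₂
  EdgesWithin-∩ W₁ W₂ = ⊆-antisym
    (λ e∈ → x∈p∩q⁺ (∈EdgesWithin⁺ (proj₁ ∘ x∈p∩q⁻ W₁ W₂ ∘ ∈EdgesWithin⁻ e∈) ,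
                    ∈EdgesWithin⁺ (proj₂ ∘ x∈p∩q⁻ W₁ W₂ ∘ ∈EdgesWithin⁻ e∈)))
    (λ e∈ → let (e∈₁ , e∈₂) = x∈p∩q⁻ (EdgesWithin W₁) (EdgesWithin W₂) e∈ in
            ∈EdgesWithin⁺ (λ w∈ → x∈p∩q⁺ (∈EdgesWithin⁻ e∈₁ w∈ , ∈EdgesWithin⁻ e∈₂ w∈)))

  covered⇒rank-unchanged : rank B ≡ a * v B → Ends x ⊆ V B → rank (B ∪ ⁅ x ⁆) ≡ rank B
  covered⇒rank-unchanged {B} {x} r≡a*v Ends⊆V = ≤-antisym (begin
    rank (B ∪ ⁅ x ⁆)    ≤⟨ rank≤a*v (B ∪ ⁅ x ⁆) ⟩
    a * v (B ∪ ⁅ x ⁆)   ≤⟨ *-monoʳ-≤ a (p⊆q⇒∣p∣≤∣q∣ V[B+x]⊆VB) ⟩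
    a * v B             ≡⟨ r≡a*v ⟨
    rank B              ∎) (rank-mono (p⊆p∪q ⁅ x ⁆))
    where
    open ≤-Reasoning
    V[B+x]⊆VB : V (B ∪ ⁅ x ⁆) ⊆ V B
    V[B+x]⊆VB w∈ with x∈p∪q⁻ (V B) (V ⁅ x ⁆) (V-∪ B ⁅ x ⁆ w∈)
    ... | inj₁ w∈VB = w∈VB
    ... | inj₂ w∈Vx with ∈V⁻ w∈Vx
    ...   | e , e∈⁅x⁆ , w∈e = Ends⊆V (subst (λ e → _ ∈ Ends e) (x∈⁅y⁆⇒x≡y x e∈⁅x⁆) w∈e)

  rank-unchanged⇒covered : rank (B ∪ ⁅ x ⁆) ≡ rank B → Ends x ⊆ V B
  rank-unchanged⇒covered {B} {x} r≡r = fromBasis (basis B)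
    where
    fromBasis : ∃ (Basis B) → Ends x ⊆ V B
    fromBasis (I , I⊆B , indI , ∣I∣≡r) with x ∈? B
    ... | yes x∈B = ∈V⁺ x∈B
    ... | no  x∉B =
      let (T , (T⊆I , _) , Ends⊆VT) = dependentExtension⇒tight indI (x∉B ∘ I⊆B) dependent
      in ⊆-trans Ends⊆VT (V-mono (⊆-trans T⊆I I⊆B))
      where
      dependent : ¬ Independent (I ∪ ⁅ x ⁆)
      dependent = basis-maximal (⊆-trans I⊆B (p⊆p∪q ⁅ x ⁆) , indI , trans ∣I∣≡r (sym r≡r))
                                (q⊆p∪q B ⁅ x ⁆ (x∈⁅x⁆ x)) (x∉B ∘ I⊆B)

  cl≡EdgesWithinV : rank B ≡ a * v B → cl B ≡ EdgesWithin (V B)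
  cl≡EdgesWithinV {B} r≡a*v = tabulate-cong λ x →
    does-⇔ (mk⇔ rank-unchanged⇒covered (covered⇒rank-unchanged r≡a*v)) (rank (B ∪ ⁅ x ⁆) ≟ rank B) (Ends x ⊆? V B)

  HasLoops : Set
  HasLoops = ∀ S → a * ∣ S ∣ ≤ ∣ EdgesWithin S ∣

  rank-EdgesWithin : HasLoops → ∀ U → rank (EdgesWithin U) ≡ a * ∣ U ∣
  rank-EdgesWithin loops U = ≤-antisym
    (≤-trans (rank≤a*v (EdgesWithin U)) (*-monoʳ-≤ a (p⊆q⇒∣p∣≤∣q∣ V-EdgesWithin)))
    (fromMinimiser (cost-minimiser (EdgesWithin U)))
    where
    fromMinimiser : ∃ (Minimiser (EdgesWithin U)) → a * ∣ U ∣ ≤ rank (EdgesWithin U)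
    fromMinimiser (Y , Y⊆E , cost≤r) = begin
      a * ∣ U ∣                           ≡⟨ cong (a *_) (q⊆p⇒∣p─q∣+∣q∣≡∣p∣ VY⊆U) ⟨
      a * (∣ U ─ V Y ∣ + v Y)              ≡⟨ *-distribˡ-+ a _ _ ⟩
      a * ∣ U ─ V Y ∣ + a * v Y            ≤⟨ +-monoˡ-≤ (a * v Y) (loops (U ─ V Y)) ⟩
      ∣ EdgesWithin (U ─ V Y) ∣ + a * v Y  ≤⟨ +-monoˡ-≤ (a * v Y) (p⊆q⇒∣p∣≤∣q∣ E[U─VY]⊆E─Y) ⟩
      cost (EdgesWithin U) Y               ≤⟨ cost≤r ⟩
      rank (EdgesWithin U)                 ∎
      where
      open ≤-Reasoning
      VY⊆U : V Y ⊆ U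
      VY⊆U = ⊆-trans (V-mono Y⊆E) V-EdgesWithin
      E[U─VY]⊆E─Y : EdgesWithin (U ─ V Y) ⊆ EdgesWithin U ─ Y
      E[U─VY]⊆E─Y {e} e∈ = x∈p∧x∉q⇒x∈p─q (∈EdgesWithin⁺ (proj₁ ∘ x∈p─q⁻ U (V Y) ∘ ∈EdgesWithin⁻ e∈))
        λ e∈Y → proj₂ (x∈p─q⁻ U (V Y) (∈EdgesWithin⁻ e∈ end∈)) (∈V⁺ e∈Y end∈)
        where
        end∈ : proj₁ (ends e) ∈ Ends e
        end∈ = x∈p∪q⁺ (inj₁ (x∈⁅x⁆ _))

  module _ {j D} (D-circuit : FoldCircuit (suc j) D) where

    private
      Bs : List (Subset nE)
      Bs = subCircuits (suc j) D

      W : Subset nV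
      W = ⋂ (map V Bs)

      ∈Bs⁻ : B ∈ₗ Bs → B ⊆ D × FoldCircuit j B
      ∈Bs⁻ = ∈subCircuits⁻ rank {suc j} {D}

      ∈Bs⁺ : B ⊆ D → FoldCircuit j B → B ∈ₗ Bs
      ∈Bs⁺ = ∈subCircuits⁺ rank {suc j} {D}

      cover : ∀ {B₁ B₂} → B₁ ∈ₗ Bs → B₂ ∈ₗ Bs → B₁ ≢ B₂ → D ⊆ B₁ ∪ B₂
      cover B₁∈ B₂∈ = distinctSubcircuits-cover D-circuit (∈Bs⁻ B₁∈) (∈Bs⁻ B₂∈)

    ∣D∣≡sum∣D─B∣ : ∣ D ∣ ≡ sum (map (λ B → ∣ D ─ B ∣) Bs)
    ∣D∣≡sum∣D─B∣ = begin
      ∣ D ∣                          ≡⟨ cong ∣_∣ D─⋂Bs≡D ⟨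
      ∣ D ─ ⋂ Bs ∣                   ≡⟨ cong ∣_∣ (⋃[p─qs]≡p─⋂qs D Bs) ⟨
      ∣ ⋃ (map (D ─_) Bs) ∣          ≡⟨ ∣⋃∣≡sum (D ─_) (subCircuits-unique rank (suc j) D) complements-disjoint ⟩
      sum (map (λ B → ∣ D ─ B ∣) Bs) ∎
      where
      open ≡-Reasoning
      avoided : ∀ {e} → e ∈ D → e ∉ ⋂ Bs
      avoided e∈D e∈⋂ =
        let (B , B⊆D , e∉B , B-circuit) = subcircuitAvoiding D-circuit e∈D
        in e∉B (x∈⋂⁻ Bs e∈⋂ (∈Bs⁺ B⊆D B-circuit))
      D─⋂Bs≡D : D ─ ⋂ Bs ≡ D
      D─⋂Bs≡D = ⊆-antisym (p─q⊆p D (⋂ Bs)) λ e∈D → x∈p∧x∉q⇒x∈p─q e∈D (avoided e∈D)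
      complements-disjoint : ∀ {B₁ B₂} → B₁ ∈ₗ Bs → B₂ ∈ₗ Bs → B₁ ≢ B₂ → Disjoint (D ─ B₁) (D ─ B₂)
      complements-disjoint B₁∈ B₂∈ B₁≢B₂ = ⊆∪⇒Disjoint─ (cover B₁∈ B₂∈ B₁≢B₂)

    sum∣VD─VB∣≡∣VD─W∣ : sum (map (λ B → ∣ V D ─ V B ∣) Bs) ≡ ∣ V D ─ W ∣
    sum∣VD─VB∣≡∣VD─W∣ = begin
      sum (map (λ B → ∣ V D ─ V B ∣) Bs)
        ≡⟨ ∣⋃∣≡sum (λ B → V D ─ V B) (subCircuits-unique rank (suc j) D) vertexComplements-disjoint ⟨
      ∣ ⋃ (map (λ B → V D ─ V B) Bs) ∣ ≡⟨ cong (∣_∣ ∘ ⋃) (map-∘ Bs) ⟩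
      ∣ ⋃ (map (V D ─_) (map V Bs)) ∣  ≡⟨ cong ∣_∣ (⋃[p─qs]≡p─⋂qs (V D) (map V Bs)) ⟩
      ∣ V D ─ W ∣                      ∎
      where
      open ≡-Reasoning
      vertexComplements-disjoint : ∀ {B₁ B₂} → B₁ ∈ₗ Bs → B₂ ∈ₗ Bs → B₁ ≢ B₂ →
                                   Disjoint (V D ─ V B₁) (V D ─ V B₂)
      vertexComplements-disjoint {B₁} {B₂} B₁∈ B₂∈ B₁≢B₂ =
        ⊆∪⇒Disjoint─ (⊆-trans (V-mono (cover B₁∈ B₂∈ B₁≢B₂)) (V-∪ B₁ B₂))

    W⊆VD : W ⊆ V D
    W⊆VD {w} = [ fromElement , (λ D≡∅ → ⊥-elim (0≢1+n (∣D∣≡0 D≡∅))) ]′ (toSum (nonempty? D))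
      where
      fromElement : Nonempty D → w ∈ W → w ∈ V D
      fromElement (e , e∈D) w∈W =
        let (B , B⊆D , _ , B-circuit) = subcircuitAvoiding D-circuit e∈D
        in V-mono B⊆D (x∈⋂⁻ (map V Bs) w∈W (∈-map⁺ V (∈Bs⁺ B⊆D B-circuit)))
      ∣D∣≡0 : Empty D → 0 ≡ suc (a * v D + j)
      ∣D∣≡0 D≡∅ = begin
        0                 ≡⟨ ∣⊥∣≡0 nE ⟨
        ∣ ⊥ {n = nE} ∣    ≡⟨ cong ∣_∣ (Empty-unique D≡∅) ⟨
        ∣ D ∣             ≡⟨ proj₁ (foldCircuit⇒excess D-circuit) ⟩
        a * v D + suc j   ≡⟨ +-suc (a * v D) j ⟩
        suc (a * v D + j) ∎
        where open ≡-Reasoning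

    ∣D─B∣≡a*∣VD─VB∣+1 : B ∈ₗ Bs → ∣ D ─ B ∣ ≡ a * ∣ V D ─ V B ∣ + 1
    ∣D─B∣≡a*∣VD─VB∣+1 {B} B∈ = +-cancelʳ-≡ (a * v B + j) _ _ (begin
      ∣ D ─ B ∣ + (a * v B + j)               ≡⟨ cong (∣ D ─ B ∣ +_) (proj₁ (foldCircuit⇒excess B-circuit)) ⟨
      ∣ D ─ B ∣ + ∣ B ∣                       ≡⟨ q⊆p⇒∣p─q∣+∣q∣≡∣p∣ B⊆D ⟩
      ∣ D ∣                                   ≡⟨ proj₁ (foldCircuit⇒excess D-circuit) ⟩
      a * v D + suc j                         ≡⟨ cong (λ t → a * t + suc j) (q⊆p⇒∣p─q∣+∣q∣≡∣p∣ (V-mono B⊆D)) ⟨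
      a * (∣ V D ─ V B ∣ + v B) + suc j       ≡⟨ cong (_+ suc j) (*-distribˡ-+ a _ _) ⟩
      (a * ∣ V D ─ V B ∣ + a * v B) + (1 + j) ≡⟨ interchange (a * ∣ V D ─ V B ∣) (a * v B) 1 j ⟩
      (a * ∣ V D ─ V B ∣ + 1) + (a * v B + j) ∎)
      where
      open ≡-Reasoning
      B⊆D : B ⊆ D
      B⊆D = proj₁ (∈Bs⁻ B∈)
      B-circuit : FoldCircuit j B
      B-circuit = proj₂ (∈Bs⁻ B∈)

    length-subCircuits : length Bs ≡ a * ∣ W ∣ + suc j
    length-subCircuits = +-cancelˡ-≡ (a * ∣ V D ─ W ∣) _ _ (begin
      a * ∣ V D ─ W ∣ + length Bs                        ≡⟨ cong (λ t → a * t + length Bs) sum∣VD─VB∣≡∣VD─W∣ ⟨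
      a * sum (map (λ B → ∣ V D ─ V B ∣) Bs) + length Bs ≡⟨ sum-map-affine a _ _ Bs (All.tabulate ∣D─B∣≡a*∣VD─VB∣+1) ⟨
      sum (map (λ B → ∣ D ─ B ∣) Bs)                     ≡⟨ ∣D∣≡sum∣D─B∣ ⟨
      ∣ D ∣                                              ≡⟨ proj₁ (foldCircuit⇒excess D-circuit) ⟩
      a * v D + suc j                                    ≡⟨ cong (λ t → a * t + suc j) (q⊆p⇒∣p─q∣+∣q∣≡∣p∣ W⊆VD) ⟨
      a * (∣ V D ─ W ∣ + ∣ W ∣) + suc j                  ≡⟨ cong (_+ suc j) (*-distribˡ-+ a _ _) ⟩
      a * ∣ V D ─ W ∣ + a * ∣ W ∣ + suc j                ≡⟨ +-assoc (a * ∣ V D ─ W ∣) _ _ ⟩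
      a * ∣ V D ─ W ∣ + (a * ∣ W ∣ + suc j)              ∎)
      where open ≡-Reasoning

    ⋂cl≡EdgesWithinW : ⋂ (map (λ A → cl (D ─ A)) (principalPartition (suc j) D)) ≡ EdgesWithin W
    ⋂cl≡EdgesWithinW = go Bs (All.tabulate (∈Bs⁻))
      where
      go : ∀ Cs → All (λ C → C ⊆ D × FoldCircuit j C) Cs →
           ⋂ (map (λ A → cl (D ─ A)) (map (D ─_) Cs)) ≡ EdgesWithin (⋂ (map V Cs))
      go []       []                          = sym EdgesWithin-⊤
      go (C ∷ Cs) ((C⊆D , C-circuit) ∷ rest) = begin
        cl (D ─ (D ─ C)) ∩ ⋂ (map (λ A → cl (D ─ A)) (map (D ─_) Cs))
          ≡⟨ cong₂ _∩_ (trans (cong cl (p─[p─q]≡q C⊆D)) (cl≡EdgesWithinV (cyclic⇒rank≡a*v (proj₁ C-circuit))))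
                       (go Cs rest) ⟩
        EdgesWithin (V C) ∩ EdgesWithin (⋂ (map V Cs)) ≡⟨ EdgesWithin-∩ (V C) _ ⟨
        EdgesWithin (V C ∩ ⋂ (map V Cs))                ∎
        where open ≡-Reasoning

  foldCircuit-balanced : HasLoops → FoldCircuit (suc j) D → Balanced (suc j) D
  foldCircuit-balanced {j} {D} loops D-circuit = begin
    rank (⋂ (map (λ A → cl (D ─ A)) (principalPartition (suc j) D))) + suc j
      ≡⟨ cong (λ X → rank X + suc j) (⋂cl≡EdgesWithinW D-circuit) ⟩
    rank (EdgesWithin (⋂ (map V (subCircuits (suc j) D)))) + suc j
      ≡⟨ cong (_+ suc j) (rank-EdgesWithin loops _) ⟩
    a * ∣ ⋂ (map V (subCircuits (suc j) D)) ∣ + suc j ≡⟨ length-subCircuits D-circuit ⟨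
    length (subCircuits (suc j) D)                    ≡⟨ length-map (D ─_) (subCircuits (suc j) D) ⟨
    length (principalPartition (suc j) D)             ∎
    where open ≡-Reasoning

-- The complete multigraph K_n^{a,0}

∣tabulate-does∣≡length-filter : ∀ {A : Set} {P : Pred A 0ℓ} (P? : Decidable P) (xs : List A) →
                                ∣ Vec.tabulate (λ i → does (P? (List.lookup xs i))) ∣ ≡ length (filter P? xs)
∣tabulate-does∣≡length-filter P? []       = refl
∣tabulate-does∣≡length-filter P? (x ∷ xs) with P? x
... | yes _ = cong suc (∣tabulate-does∣≡length-filter P? xs)
... | no  _ = ∣tabulate-does∣≡length-filter P? xs

length-filter-++ : ∀ {A : Set} {P : Pred A 0ℓ} (P? : Decidable P) (xs ys : List A) →
                   length (filter P? (xs ++ ys)) ≡ length (filter P? xs) + length (filter P? ys)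
length-filter-++ P? xs ys = trans (cong length (filter-++ P? xs ys)) (length-++ (filter P? xs))

module _ (n a : ℕ) {{a≢0 : NonZero a}} where
  open CountMatroidProperties a (K n a 0)

  K-hasLoops : HasLoops
  K-hasLoops S = begin
    a * ∣ S ∣                                    ≡⟨ cong (λ T → a * ∣ T ∣) (tabulate∘lookup S) ⟨
    a * ∣ Vec.tabulate (lookup S) ∣               ≡⟨ length-filter-loops (λ v → v) ⟨
    length (filter Within? loops)                 ≤⟨ m≤m+n _ _ ⟩
    length (filter Within? loops) + length (filter Within? links) ≡⟨ length-filter-++ Within? loops links ⟨
    length (filter Within? (Kedges n a 0))        ≡⟨ ∣tabulate-does∣≡length-filter Within? (Kedges n a 0) ⟨
    ∣ EdgesWithin S ∣                            ∎
    where
    open ≤-Reasoning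
    Within : Pred (Fin n × Fin n) 0ℓ
    Within (u , v) = ⁅ u ⁆ ∪ ⁅ v ⁆ ⊆ S
    Within? : Decidable Within
    Within? (u , v) = ⁅ u ⁆ ∪ ⁅ v ⁆ ⊆? S
    loopsAt : Fin n → List (Fin n × Fin n)
    loopsAt v = replicate a (v , v)
    -- Kedges n a 0 is definitionally loops ++ links.
    loops links : List (Fin n × Fin n)
    loops = concatMap loopsAt (allFin n)
    links = concatMap (λ u → concatMap (λ v → if does (u Fin.<? v) then replicate (2 * a ∸ 0) (u , v) else []) (allFin n))
                      (allFin n)
    loop-within : ∀ {v} → lookup S v ≡ inside → Within (v , v)
    loop-within {v} v∈S w∈ with x∈p∪q⁻ ⁅ v ⁆ ⁅ v ⁆ w∈
    ... | inj₁ w∈⁅v⁆ = subst (_∈ S) (sym (x∈⁅y⁆⇒x≡y v w∈⁅v⁆)) (lookup⇒[]= v S v∈S)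
    ... | inj₂ w∈⁅v⁆ = subst (_∈ S) (sym (x∈⁅y⁆⇒x≡y v w∈⁅v⁆)) (lookup⇒[]= v S v∈S)
    loop-notWithin : ∀ {v} → lookup S v ≡ outside → ¬ Within (v , v)
    loop-notWithin {v} v∉S within with trans (sym v∉S) ([]=⇒lookup (within (x∈p∪q⁺ (inj₁ (x∈⁅x⁆ v)))))
    ... | ()
    length-filter-loops : ∀ {k} (f : Fin k → Fin n) →
      length (filter Within? (concatMap loopsAt (List.tabulate f))) ≡ a * ∣ Vec.tabulate (λ i → lookup S (f i)) ∣
    length-filter-loops {zero}  f = sym (*-zeroʳ a)
    length-filter-loops {suc k} f with lookup S (f zero) in f₀∈?S
    ... | inside  = trans (length-filter-++ Within? (loopsAt (f zero)) (concatMap loopsAt (List.tabulate (f ∘ suc))))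
      (trans (cong₂ _+_ (trans (cong length (filter-all Within? (replicate⁺ a (loop-within f₀∈?S)))) (length-replicate a))
                        (length-filter-loops (f ∘ suc)))
             (sym (*-suc a _)))
    ... | outside = trans (length-filter-++ Within? (loopsAt (f zero)) (concatMap loopsAt (List.tabulate (f ∘ suc))))
      (cong₂ _+_ (cong length (filter-none Within? (replicate⁺ a (loop-notWithin f₀∈?S))))
                 (length-filter-loops (f ∘ suc)))

mainTheorem20 : (a : ℕ) → 0 < a → (n : ℕ) → 1 ≤ n → (k : ℕ) → 1 ≤ k →
    HasKFoldCircuitProperty n a 0 k
mainTheorem20 a 0<a n _ (suc j) _ _ = foldCircuit-balanced (K-hasLoops n a)
  where
  instance
    a≢0 : NonZero a
    a≢0 = >-nonZero 0<a
  open CountMatroidProperties a (K n a 0)
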